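{- Let $m\ge2$, $j\in[2,m]$, and let $S_1=\{(1,m+1),(j,m+2)\}\in\mathrm{Sub}(\beta_{m,2})$. Then $S_1$ is valid if and only if $m+j$ is even.
   Context: For $N\ge1$, $[N]=\{1,\dots,N\}$. In the MVP parking process for a preference $p\in[N]^N$, cars $1,\dots,N$ enter in order a one-way street with spots $1,\dots,N$; car $i$ parks in spot $p_i$, and if $p_i$ was occupied by an earlier car $j$, car $j$ is bumped and parks in the first unoccupied spot $k>p_i$ (bumped cars do not bump others). The outcome $\mathcal{O}_{\mathrm{MVP}_N}(p)$ (when all cars park) is the permutation $\pi$ with $\pi_i$ the car in spot $i$ at the end. For $\pi\in S_N$, $\mathrm{Inv}(\pi)=\{(j,i):j<i,\ \pi_j>\pi_i\}$ and $\mathrm{Sub}(\pi)$ is the set of $S\subseteq\mathrm{Inv}(\pi)$ such that each $i$ has at most one $j$ with $(j,i)\in S$. For $S\in\mathrm{Sub}(\pi)$, $\Psi_{\mathrm{Sub}\to\mathrm{PF}}(S)$ is the preference $p$ with $p_{\pi_i}=i$ if no $(j,i)\in S$ and $p_{\pi_i}=j$ if $(j,i)\in S$; $S$ is valid if all cars park for $\Psi_{\mathrm{Sub}\to\mathrm{PF}}(S)$ and $\mathcal{O}_{\mathrm{MVP}_N}(\Psi_{\mathrm{Sub}\to\mathrm{PF}}(S))=\pi$. $\beta_{m,2}=3\,4\cdots(m+2)\,1\,2\in S_{m+2}$. -}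

module Defs where

open import Data.Nat using (ℕ; zero; suc; _+_; _∸_; _≡ᵇ_; _<ᵇ_)
open import Data.Bool using (Bool; true; false; if_then_else_; _∧_)
open import Data.Maybe using (Maybe; just; nothing)
open import Data.List using (List; []; _∷_; _++_; map; length)
open import Data.List.Base using (upTo)
open import Data.Product using (_×_; _,_)
open import Relation.Binary.PropositionalEquality using (_≡_)

-- Conventions: everything is 1-indexed.  A permutation π ∈ S_N is the list
-- [π_1, …, π_N]; a preference p ∈ [N]^N is the list [p_1, …, p_N]; a parking
-- configuration is a list of N spots, each empty (nothing) or holding a car.

-- 1-indexed lookup (index 0 or out of range gives nothing)
at : {A : Set} → List A → ℕ → Maybe A
at []       _             = nothing
at (x ∷ xs) zero          = nothing
at (x ∷ xs) (suc zero)    = just x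
at (x ∷ xs) (suc (suc k)) = at xs (suc k)

setAt : {A : Set} → List A → ℕ → A → List A
setAt []       _             v = []
setAt (x ∷ xs) zero          v = x ∷ xs
setAt (x ∷ xs) (suc zero)    v = v ∷ xs
setAt (x ∷ xs) (suc (suc k)) v = x ∷ setAt xs (suc k) v

firstFreeAfter' : List (Maybe ℕ) → ℕ → ℕ → Maybe ℕ
firstFreeAfter' []            a k = nothing
firstFreeAfter' (nothing ∷ s) a k = if a <ᵇ k then just k else firstFreeAfter' s a (suc k)
firstFreeAfter' (just _ ∷ s)  a k = firstFreeAfter' s a (suc k)

firstFreeAfter : List (Maybe ℕ) → ℕ → Maybe ℕ
firstFreeAfter s a = firstFreeAfter' s a 1

-- one MVP step: car c arrives with preferred spot a.
-- nothing = some car fails to park (preference out of range, or a bumped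
-- car finds no free spot after a).
mvpStep : List (Maybe ℕ) → ℕ → ℕ → Maybe (List (Maybe ℕ))
mvpStep s c a with at s a
... | nothing           = nothing
... | just nothing      = just (setAt s a (just c))
... | just (just d) with firstFreeAfter s a
...   | nothing = nothing
...   | just k  = just (setAt (setAt s a (just c)) k (just d))

mvpRun : List (Maybe ℕ) → ℕ → List ℕ → Maybe (List (Maybe ℕ))
mvpRun s c []       = just s
mvpRun s c (a ∷ as) with mvpStep s c a
... | nothing = nothing
... | just s' = mvpRun s' (suc c) as

emptyStreet : ℕ → List (Maybe ℕ)
emptyStreet zero    = []
emptyStreet (suc n) = nothing ∷ emptyStreet n

allParked : List (Maybe ℕ) → Maybe (List ℕ)
allParked []             = just []
allParked (nothing ∷ s)  = nothing
allParked (just c ∷ s) with allParked s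
... | nothing = nothing
... | just cs = just (c ∷ cs)

-- O_MVP_N(p): just π if all cars park (π_i = car in spot i), nothing otherwise
outcomeMVP : List ℕ → Maybe (List ℕ)
outcomeMVP p with mvpRun (emptyStreet (length p)) 1 p
... | nothing = nothing
... | just s  = allParked s

-- position (1-indexed) of value c in π (0 if absent)
posOf' : List ℕ → ℕ → ℕ → ℕ
posOf' []       c k = 0
posOf' (x ∷ xs) c k = if x ≡ᵇ c then k else posOf' xs c (suc k)

posOf : List ℕ → ℕ → ℕ
posOf π c = posOf' π c 1

-- subsets of inversions: lists of pairs (j , i)
-- the j with (j , i) ∈ S, if any (S ∈ Sub(π) has at most one such j)
partner : List (ℕ × ℕ) → ℕ → Maybe ℕ
partner []             i = nothing
partner ((j , i') ∷ S) i = if i' ≡ᵇ i then just j else partner S i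

-- Ψ_{Sub→PF}(S): p_{π_i} = j if (j,i) ∈ S, else i.  As a list indexed by cars.
prefOfCar : List ℕ → List (ℕ × ℕ) → ℕ → ℕ
prefOfCar π S c with partner S (posOf π c)
... | nothing = posOf π c
... | just j  = j

Ψ : List ℕ → List (ℕ × ℕ) → List ℕ
Ψ π S = map (prefOfCar π S) (map suc (upTo (length π)))

Valid : List ℕ → List (ℕ × ℕ) → Set
Valid π S = outcomeMVP (Ψ π S) ≡ just π

β2 : ℕ → List ℕ
β2 m = map (λ k → k + 3) (upTo m) ++ (1 ∷ 2 ∷ [])

S₁ : ℕ → ℕ → List (ℕ × ℕ)
S₁ m j = (1 , m + 1) ∷ (j , m + 2) ∷ []

-- In Ψ(S₁) car 1 prefers spot 1, car 2 prefers spot j and car i+3 prefers spot i+1.  Car 1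
-- parks at 1 and car 2 at j.  Each of the cars 3, …, j then takes the spot of car 1 and bumps
-- it one spot to the right, into the gap, so afterwards spots 1, …, j−2 hold cars 3, …, j and
-- cars 1, 2 stand side by side at j−1, j.  Each of the remaining b = m − j + 2 cars takes the
-- spot of the left car of this pair and bumps it past the right one: the pair moves one spot
-- to the right and changes its order.  So the outcome is β_{m,2} exactly when b, equivalently
-- m + j, is even.

module Submission where

open import Defs
open import Data.Nat using (ℕ; _≤_; _+_)
open import Data.Nat.Divisibility using (_∣_)
open import Function.Bundles using (_⇔_)

open import Data.Nat using (zero; suc; _*_; _<_; _≡ᵇ_; _<ᵇ_; s≤s; z≤n; z<s)
open import Data.Nat.Properties
open import Data.Nat.Divisibility using (divides; ∣-refl; ∣1⇒≡1; ∣m∣n⇒∣m+n; ∣m+n∣m⇒∣n; m∣m*n)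
open import Data.Nat.Tactic.RingSolver using (solve-∀)
open import Data.Bool using (true; false)
open import Data.Bool.Properties using (T-≡; ¬-not)
open import Data.Empty using (⊥-elim)
open import Data.Maybe using (Maybe; just; nothing)
open import Data.Maybe.Properties using (just-injective)
open import Data.Product using (_×_; _,_; proj₁; proj₂; swap)
open import Data.List using (List; []; _∷_; _++_; [_]; map; length; iterate; applyUpTo; upTo)
open import Data.List.Properties
  using (length-map; length-++; length-iterate; map-++; map-upTo; ++-assoc; ++-identityʳ; ++-cancelˡ)
open import Function using (_∘_)
open import Function.Bundles using (mk⇔; Equivalence)
open import Function.Properties.Equivalence using () renaming (trans to ⇔-trans)
open import Relation.Binary.PropositionalEquality
  using (_≡_; _≢_; refl; sym; trans; cong; cong₂; subst; module ≡-Reasoning)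
open ≡-Reasoning

≡ᵇ-refl : ∀ n → (n ≡ᵇ n) ≡ true
≡ᵇ-refl n = Equivalence.to T-≡ (≡⇒≡ᵇ n n refl)

≢⇒≡ᵇ≡false : ∀ {m n} → m ≢ n → (m ≡ᵇ n) ≡ false
≢⇒≡ᵇ≡false {m} {n} m≢n = ¬-not (m≢n ∘ ≡ᵇ⇒≡ m n ∘ Equivalence.from T-≡)

<⇒<ᵇ≡true : ∀ {m n} → m < n → (m <ᵇ n) ≡ true
<⇒<ᵇ≡true = Equivalence.to T-≡ ∘ <⇒<ᵇ

applyUpTo-iterate : ∀ {A : Set} (f : ℕ → A) (g : A → A) n → (∀ i → f (suc i) ≡ g (f i)) →
                    applyUpTo f n ≡ iterate g (f 0) n
applyUpTo-iterate f g zero    step = refl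
applyUpTo-iterate f g (suc n) step = cong (f 0 ∷_)
  (trans (applyUpTo-iterate (f ∘ suc) g n (step ∘ suc)) (cong (λ x → iterate g x n) (step 0)))

iterate-suc-+ : ∀ s a b → iterate suc s (a + b) ≡ iterate suc s a ++ iterate suc (a + s) b
iterate-suc-+ s zero    b = refl
iterate-suc-+ s (suc a) b = cong (s ∷_)
  (trans (iterate-suc-+ (suc s) a b) (cong (λ t → iterate suc (suc s) a ++ iterate suc t b) (+-suc a s)))

map-iterate-suc : ∀ (f : ℕ → ℕ) n s t → (∀ {i} → i < n → f (i + s) ≡ i + t) →
                  map f (iterate suc s n) ≡ iterate suc t n
map-iterate-suc f zero    s t shift = refl
map-iterate-suc f (suc n) s t shift = cong₂ _∷_ (shift z<s) (map-iterate-suc f n (suc s) (suc t) shift′)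
  where
  shift′ : ∀ {i} → i < n → f (i + suc s) ≡ i + suc t
  shift′ {i} i<n rewrite +-suc i s | +-suc i t = shift (s≤s i<n)

length-∷ʳ : ∀ {A : Set} (xs : List A) x → length (xs ++ [ x ]) ≡ suc (length xs)
length-∷ʳ xs x = trans (length-++ xs) (+-comm (length xs) 1)

pair-∷ʳ-injective : ∀ {A : Set} (xs : List A) {x y u v} →
                    xs ++ x ∷ y ∷ [] ≡ xs ++ u ∷ v ∷ [] → (x , y) ≡ (u , v)
pair-∷ʳ-injective xs eq with ++-cancelˡ xs _ _ eq
... | refl = refl

posOf'-iterate-miss : ∀ {c s} → c < s → ∀ n ys k →
                      posOf' (iterate suc s n ++ ys) c k ≡ posOf' ys c (n + k)
posOf'-iterate-miss c<s zero    ys k = refl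
posOf'-iterate-miss {c} c<s (suc n) ys k rewrite ≢⇒≡ᵇ≡false (>⇒≢ c<s) =
  trans (posOf'-iterate-miss (m<n⇒m<1+n c<s) n ys (suc k)) (cong (posOf' ys c) (+-suc n k))

posOf'-iterate-hit : ∀ {i n} → i < n → ∀ s ys k → posOf' (iterate suc s n ++ ys) (i + s) k ≡ i + k
posOf'-iterate-hit {zero}  {suc n} _         s ys k rewrite ≡ᵇ-refl s = refl
posOf'-iterate-hit {suc i} {suc n} (s≤s i<n) s ys k rewrite ≢⇒≡ᵇ≡false (m≢1+n+m s {i}) = begin
  posOf' rest (suc i + s) (suc k) ≡⟨ cong (λ c → posOf' rest c (suc k)) (sym (+-suc i s)) ⟩
  posOf' rest (i + suc s) (suc k) ≡⟨ posOf'-iterate-hit i<n (suc s) ys (suc k) ⟩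
  i + suc k                       ≡⟨ +-suc i k ⟩
  suc i + k                       ∎
  where
  rest : List ℕ
  rest = iterate suc (suc s) n ++ ys

prefOfCar-unpaired : ∀ π S c → partner S (posOf π c) ≡ nothing → prefOfCar π S c ≡ posOf π c
prefOfCar-unpaired π S c eq rewrite eq = refl

prefOfCar-paired : ∀ π S c {j} → partner S (posOf π c) ≡ just j → prefOfCar π S c ≡ j
prefOfCar-paired π S c eq rewrite eq = refl

-- The length of the prefix is given by an equation, so that a prefix `map just P` can be
-- addressed through `length P`.
at-++ : ∀ {A : Set} (xs : List A) {ys L} n → length xs ≡ L → at (xs ++ ys) (suc (n + L)) ≡ at ys (suc n)
at-++ []       n refl rewrite +-identityʳ n = refl
at-++ (x ∷ xs) n refl rewrite +-suc n (length xs) = at-++ xs n refl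

setAt-++ : ∀ {A : Set} (xs : List A) {ys L} n v → length xs ≡ L →
           setAt (xs ++ ys) (suc (n + L)) v ≡ xs ++ setAt ys (suc n) v
setAt-++ []       n v refl rewrite +-identityʳ n = refl
setAt-++ (x ∷ xs) n v refl rewrite +-suc n (length xs) = cong (x ∷_) (setAt-++ xs n v refl)

firstFreeAfter'-++ : ∀ (P : List ℕ) ys a k →
                     firstFreeAfter' (map just P ++ ys) a k ≡ firstFreeAfter' ys a (k + length P)
firstFreeAfter'-++ []      ys a k = cong (firstFreeAfter' ys a) (sym (+-identityʳ k))
firstFreeAfter'-++ (p ∷ P) ys a k =
  trans (firstFreeAfter'-++ P ys a (suc k)) (cong (firstFreeAfter' ys a) (sym (+-suc k (length P))))

mvpStep-park : ∀ xs {ys L} c → length xs ≡ L →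
               mvpStep (xs ++ nothing ∷ ys) c (suc L) ≡ just (xs ++ just c ∷ ys)
mvpStep-park xs {ys} c len
  rewrite at-++ xs {nothing ∷ ys} 0 len | setAt-++ xs {nothing ∷ ys} 0 (just c) len = refl

mvpStep-bump-next : ∀ P x c R → mvpStep (map just P ++ just x ∷ nothing ∷ R) c (suc (length P))
                                ≡ just (map just P ++ just c ∷ just x ∷ R)
mvpStep-bump-next P x c R
  rewrite at-++ (map just P) {just x ∷ nothing ∷ R} 0 (length-map just P)
        | firstFreeAfter'-++ P (just x ∷ nothing ∷ R) (suc (length P)) 1
        | <⇒<ᵇ≡true (n<1+n (length P))
        | setAt-++ (map just P) {just x ∷ nothing ∷ R} 0 (just c) (length-map just P)
        | setAt-++ (map just P) {just c ∷ nothing ∷ R} 1 (just x) (length-map just P)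
        = refl

mvpStep-bump-past : ∀ P x y c R → mvpStep (map just P ++ just x ∷ just y ∷ nothing ∷ R) c (suc (length P))
                                  ≡ just (map just P ++ just c ∷ just y ∷ just x ∷ R)
mvpStep-bump-past P x y c R
  rewrite at-++ (map just P) {just x ∷ just y ∷ nothing ∷ R} 0 (length-map just P)
        | firstFreeAfter'-++ P (just x ∷ just y ∷ nothing ∷ R) (suc (length P)) 1
        | <⇒<ᵇ≡true (m<n⇒m<1+n (n<1+n (length P)))
        | setAt-++ (map just P) {just x ∷ just y ∷ nothing ∷ R} 0 (just c) (length-map just P)
        | setAt-++ (map just P) {just c ∷ just y ∷ nothing ∷ R} 2 (just x) (length-map just P)
        = refl

mvpRun-∷ : ∀ s {s'} c a as → mvpStep s c a ≡ just s' → mvpRun s c (a ∷ as) ≡ mvpRun s' (suc c) as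
mvpRun-∷ s c a as eq rewrite eq = refl

outcomeMVP-run : ∀ p {s} → mvpRun (emptyStreet (length p)) 1 p ≡ just s → outcomeMVP p ≡ allParked s
outcomeMVP-run p eq rewrite eq = refl

emptyStreet-+ : ∀ a b → emptyStreet (a + b) ≡ emptyStreet a ++ emptyStreet b
emptyStreet-+ zero    b = refl
emptyStreet-+ (suc a) b = cong (nothing ∷_) (emptyStreet-+ a b)

length-emptyStreet : ∀ n → length (emptyStreet n) ≡ n
length-emptyStreet zero    = refl
length-emptyStreet (suc n) = cong suc (length-emptyStreet n)

allParked-map-just : ∀ cs → allParked (map just cs) ≡ just cs
allParked-map-just []       = refl
allParked-map-just (c ∷ cs) rewrite allParked-map-just cs = refl

layout : List ℕ → ℕ × ℕ → ℕ → ℕ → List (Maybe ℕ)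
layout P p a b = map just P ++ just (proj₁ p) ∷ emptyStreet a ++ just (proj₂ p) ∷ emptyStreet b

layout-∷ʳ : ∀ P c p a b → map just P ++ just c ∷ layout [] p a b ≡ layout (P ++ [ c ]) p a b
layout-∷ʳ P c p a b = sym (trans (cong (_++ _) (map-++ just P [ c ])) (++-assoc (map just P) [ just c ] _))

swapⁿ : {A : Set} → ℕ → A × A → A × A
swapⁿ zero    p = p
swapⁿ (suc n) p = swapⁿ n (swap p)

mvpStep-layout-gap : ∀ P p a b c →
  mvpStep (layout P p (suc a) b) c (suc (length P)) ≡ just (layout (P ++ [ c ]) p a b)
mvpStep-layout-gap P p a b c =
  trans (mvpStep-bump-next P (proj₁ p) c (emptyStreet a ++ just (proj₂ p) ∷ emptyStreet b))
        (cong just (layout-∷ʳ P c p a b))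

mvpStep-layout-adjacent : ∀ P p b c →
  mvpStep (layout P p 0 (suc b)) c (suc (length P)) ≡ just (layout (P ++ [ c ]) (swap p) 0 b)
mvpStep-layout-adjacent P p b c = trans (mvpStep-bump-past P (proj₁ p) (proj₂ p) c (emptyStreet b))
                                        (cong just (layout-∷ʳ P c (swap p) 0 b))

gap-phase : ∀ a P p b c n →
  mvpRun (layout P p a b) c (iterate suc (suc (length P)) (a + n))
  ≡ mvpRun (layout (P ++ iterate suc c a) p 0 b) (a + c) (iterate suc (suc (length (P ++ iterate suc c a))) n)
gap-phase zero    P p b c n rewrite ++-identityʳ P = refl
gap-phase (suc a) P p b c n = begin
  mvpRun (layout P p (suc a) b) c (suc (length P) ∷ prefs (suc (length P)))
    ≡⟨ mvpRun-∷ (layout P p (suc a) b) c _ _ (mvpStep-layout-gap P p a b c) ⟩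
  mvpRun (layout (P ++ [ c ]) p a b) (suc c) (prefs (suc (length P)))
    ≡⟨ cong (mvpRun (layout (P ++ [ c ]) p a b) (suc c) ∘ prefs) (sym (length-∷ʳ P c)) ⟩
  mvpRun (layout (P ++ [ c ]) p a b) (suc c) (prefs (length (P ++ [ c ])))
    ≡⟨ gap-phase a (P ++ [ c ]) p b (suc c) n ⟩
  mvpRun (layout Q p 0 b) (a + suc c) (iterate suc (suc (length Q)) n)
    ≡⟨ cong₂ (λ Q d → mvpRun (layout Q p 0 b) d (iterate suc (suc (length Q)) n))
             (++-assoc P [ c ] _) (+-suc a c) ⟩
  mvpRun (layout P′ p 0 b) (suc a + c) (iterate suc (suc (length P′)) n)
    ∎
  where
  prefs : ℕ → List ℕ
  prefs L = iterate suc (suc L) (a + n)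
  Q P′ : List ℕ
  Q = (P ++ [ c ]) ++ iterate suc (suc c) a
  P′ = P ++ iterate suc c (suc a)

swap-phase : ∀ b P p c →
  mvpRun (layout P p 0 b) c (iterate suc (suc (length P)) b) ≡ just (layout (P ++ iterate suc c b) (swapⁿ b p) 0 0)
swap-phase zero    P p c rewrite ++-identityʳ P = refl
swap-phase (suc b) P p c = begin
  mvpRun (layout P p 0 (suc b)) c (suc (length P) ∷ prefs (suc (length P)))
    ≡⟨ mvpRun-∷ (layout P p 0 (suc b)) c _ _ (mvpStep-layout-adjacent P p b c) ⟩
  mvpRun (layout (P ++ [ c ]) (swap p) 0 b) (suc c) (prefs (suc (length P)))
    ≡⟨ cong (mvpRun (layout (P ++ [ c ]) (swap p) 0 b) (suc c) ∘ prefs) (sym (length-∷ʳ P c)) ⟩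
  mvpRun (layout (P ++ [ c ]) (swap p) 0 b) (suc c) (prefs (length (P ++ [ c ])))
    ≡⟨ swap-phase b (P ++ [ c ]) (swap p) (suc c) ⟩
  just (layout ((P ++ [ c ]) ++ iterate suc (suc c) b) (swapⁿ (suc b) p) 0 0)
    ≡⟨ cong (λ Q → just (layout Q (swapⁿ (suc b) p) 0 0)) (++-assoc P [ c ] _) ⟩
  just (layout (P ++ iterate suc c (suc b)) (swapⁿ (suc b) p) 0 0)
    ∎
  where
  prefs : ℕ → List ℕ
  prefs L = iterate suc (suc L) b

β2-iterate : ∀ m → β2 m ≡ iterate suc 3 m ++ 1 ∷ 2 ∷ []
β2-iterate m = cong (_++ 1 ∷ 2 ∷ []) (trans (map-upTo (_+ 3) m) (applyUpTo-iterate (_+ 3) suc m (λ _ → refl)))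

partner-S₁-first : ∀ m j → partner (S₁ m j) (m + 1) ≡ just 1
partner-S₁-first m j rewrite ≡ᵇ-refl (m + 1) = refl

partner-S₁-second : ∀ m j → partner (S₁ m j) (m + 2) ≡ just j
partner-S₁-second m j rewrite ≢⇒≡ᵇ≡false ((λ ()) ∘ +-cancelˡ-≡ m 1 2) | ≡ᵇ-refl (m + 2) = refl

partner-S₁-< : ∀ m j {n} → n < m + 1 → partner (S₁ m j) n ≡ nothing
partner-S₁-< m j n<m+1
  rewrite ≢⇒≡ᵇ≡false (>⇒≢ n<m+1)
        | ≢⇒≡ᵇ≡false (>⇒≢ (<-≤-trans n<m+1 (+-monoʳ-≤ m (s≤s (z≤n {1}))))) = refl

Ψ-β2-S₁ : ∀ m j → Ψ (β2 m) (S₁ m j) ≡ 1 ∷ j ∷ iterate suc 1 m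
Ψ-β2-S₁ m j = begin
  Ψ (β2 m) S
    ≡⟨ cong (λ π → Ψ π S) (β2-iterate m) ⟩
  map pref (map suc (upTo (length π)))
    ≡⟨ cong (map pref ∘ map suc ∘ upTo)
            (trans (length-++ (iterate suc 3 m)) (cong (_+ 2) (length-iterate suc 3 m))) ⟩
  map pref (map suc (upTo (m + 2)))
    ≡⟨ cong (map pref) (trans (map-upTo suc (m + 2)) (applyUpTo-iterate suc suc (m + 2) (λ _ → refl))) ⟩
  map pref (iterate suc 1 (m + 2))
    ≡⟨ cong (map pref ∘ iterate suc 1) (+-comm m 2) ⟩
  map pref (1 ∷ 2 ∷ iterate suc 3 m)
    ≡⟨ cong₂ _∷_ pref-1 (cong₂ _∷_ pref-2 (map-iterate-suc pref m 3 1 pref-shift)) ⟩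
  1 ∷ j ∷ iterate suc 1 m
    ∎
  where
  S : List (ℕ × ℕ)
  S = S₁ m j
  π : List ℕ
  π = iterate suc 3 m ++ 1 ∷ 2 ∷ []
  pref : ℕ → ℕ
  pref = prefOfCar π S

  posOf-1 : posOf π 1 ≡ m + 1
  posOf-1 = posOf'-iterate-miss (s≤s (s≤s z≤n)) m (1 ∷ 2 ∷ []) 1

  posOf-2 : posOf π 2 ≡ m + 2
  posOf-2 = trans (posOf'-iterate-miss (s≤s (s≤s (s≤s z≤n))) m (1 ∷ 2 ∷ []) 1) (sym (+-suc m 1))

  pref-1 : pref 1 ≡ 1
  pref-1 = prefOfCar-paired π S 1 (trans (cong (partner S) posOf-1) (partner-S₁-first m j))

  pref-2 : pref 2 ≡ j
  pref-2 = prefOfCar-paired π S 2 (trans (cong (partner S) posOf-2) (partner-S₁-second m j))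

  pref-shift : ∀ {i} → i < m → pref (i + 3) ≡ i + 1
  pref-shift {i} i<m =
    trans (prefOfCar-unpaired π S (i + 3) (trans (cong (partner S) posOf-i) (partner-S₁-< m j (+-monoˡ-< 1 i<m))))
          posOf-i
    where
    posOf-i : posOf π (i + 3) ≡ i + 1
    posOf-i = posOf'-iterate-hit i<m 3 (1 ∷ 2 ∷ []) 1

mvpRun-β2-S₁ : ∀ j' b →
  mvpRun (emptyStreet (2 + (j' + b))) 1 (1 ∷ 2 + j' ∷ iterate suc 1 (j' + b))
  ≡ just (layout (iterate suc 3 (j' + b)) (swapⁿ b (1 , 2)) 0 0)
mvpRun-β2-S₁ j' b = begin
  mvpRun (just 1 ∷ emptyStreet (suc (j' + b))) 2 (2 + j' ∷ prefs)
    ≡⟨ cong (λ s → mvpRun (just 1 ∷ s) 2 (2 + j' ∷ prefs)) street ⟩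
  mvpRun (just 1 ∷ emptyStreet j' ++ nothing ∷ emptyStreet b) 2 (2 + j' ∷ prefs)
    ≡⟨ mvpRun-∷ (just 1 ∷ emptyStreet j' ++ nothing ∷ emptyStreet b) 2 (2 + j') prefs
                (mvpStep-park (just 1 ∷ emptyStreet j') {emptyStreet b} 2 (cong suc (length-emptyStreet j'))) ⟩
  mvpRun (layout [] (1 , 2) j' b) 3 prefs
    ≡⟨ gap-phase j' [] (1 , 2) b 3 b ⟩
  mvpRun (layout P (1 , 2) 0 b) (j' + 3) (iterate suc (suc (length P)) b)
    ≡⟨ swap-phase b P (1 , 2) (j' + 3) ⟩
  just (layout (P ++ iterate suc (j' + 3) b) (swapⁿ b (1 , 2)) 0 0)
    ≡⟨ cong (λ Q → just (layout Q (swapⁿ b (1 , 2)) 0 0)) (sym (iterate-suc-+ 3 j' b)) ⟩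
  just (layout (iterate suc 3 (j' + b)) (swapⁿ b (1 , 2)) 0 0)
    ∎
  where
  P prefs : List ℕ
  P = iterate suc 3 j'
  prefs = iterate suc 1 (j' + b)
  street : emptyStreet (suc (j' + b)) ≡ emptyStreet j' ++ nothing ∷ emptyStreet b
  street = trans (cong emptyStreet (sym (+-suc j' b))) (emptyStreet-+ j' (suc b))

outcome-β2-S₁ : ∀ j' b → let m = j' + b ; (u , v) = swapⁿ b (1 , 2) in
  outcomeMVP (Ψ (β2 m) (S₁ m (2 + j'))) ≡ just (iterate suc 3 m ++ u ∷ v ∷ [])
outcome-β2-S₁ j' b = begin
  outcomeMVP (Ψ (β2 m) (S₁ m (2 + j')))
    ≡⟨ cong outcomeMVP (Ψ-β2-S₁ m (2 + j')) ⟩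
  outcomeMVP prefs
    ≡⟨ outcomeMVP-run prefs (trans (cong (λ n → mvpRun (emptyStreet (2 + n)) 1 prefs) (length-iterate suc 1 m))
                                   (mvpRun-β2-S₁ j' b)) ⟩
  allParked (layout Q p 0 0)
    ≡⟨ cong allParked (sym (map-++ just Q _)) ⟩
  allParked (map just (Q ++ proj₁ p ∷ proj₂ p ∷ []))
    ≡⟨ allParked-map-just _ ⟩
  just (Q ++ proj₁ p ∷ proj₂ p ∷ [])
    ∎
  where
  m : ℕ
  m = j' + b
  p : ℕ × ℕ
  p = swapⁿ b (1 , 2)
  Q prefs : List ℕ
  Q = iterate suc 3 m
  prefs = 1 ∷ 2 + j' ∷ iterate suc 1 m

valid⇔swapⁿ-fixes : ∀ j' b → let m = j' + b in
                    Valid (β2 m) (S₁ m (2 + j')) ⇔ (swapⁿ b (1 , 2) ≡ (1 , 2))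
valid⇔swapⁿ-fixes j' b = mk⇔
  (λ valid → pair-∷ʳ-injective Q
     (just-injective (trans (sym (outcome-β2-S₁ j' b)) (trans valid (cong just (β2-iterate m))))))
  (λ fixed → trans (outcome-β2-S₁ j' b)
     (cong just (trans (cong (λ p → Q ++ proj₁ p ∷ proj₂ p ∷ []) fixed) (sym (β2-iterate m)))))
  where
  m : ℕ
  m = j' + b
  Q : List ℕ
  Q = iterate suc 3 m

swapⁿ-fixes⇔even : ∀ {A : Set} {x y : A} → x ≢ y → ∀ n → (swapⁿ n (x , y) ≡ (x , y)) ⇔ 2 ∣ n
swapⁿ-fixes⇔even x≢y zero          = mk⇔ (λ _ → divides 0 refl) (λ _ → refl)
swapⁿ-fixes⇔even x≢y (suc zero)    =
  mk⇔ (λ yx≡xy → ⊥-elim (x≢y (sym (cong proj₁ yx≡xy)))) (λ 2∣1 → ⊥-elim (2≢1 (∣1⇒≡1 2∣1)))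
  where
  2≢1 : 2 ≢ 1
  2≢1 ()
swapⁿ-fixes⇔even x≢y (suc (suc n)) =
  ⇔-trans (swapⁿ-fixes⇔even x≢y n) (mk⇔ (∣m∣n⇒∣m+n ∣-refl) (λ 2∣2+n → ∣m+n∣m⇒∣n 2∣2+n ∣-refl))

m∣n⇔m∣m*k+n : ∀ m k {n} → m ∣ n ⇔ m ∣ m * k + n
m∣n⇔m∣m*k+n m k = mk⇔ (∣m∣n⇒∣m+n (m∣m*n k)) (λ m∣m*k+n → ∣m+n∣m⇒∣n m∣m*k+n (m∣m*n k))

2*[1+i]+b≡i+b+[2+i] : ∀ i b → 2 * suc i + b ≡ i + b + (2 + i)
2*[1+i]+b≡i+b+[2+i] = solve-∀

lemma4p6 : (m j : ℕ) → 2 ≤ m → 2 ≤ j → j ≤ m →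
    (Valid (β2 m) (S₁ m j) ⇔ (2 ∣ m + j))
lemma4p6 m (suc (suc j')) _ (s≤s (s≤s _)) j≤m with m≤n⇒∃[o]m+o≡n (≤-trans (m≤n+m j' 2) j≤m)
... | b , refl =
  ⇔-trans (valid⇔swapⁿ-fixes j' b)
  (⇔-trans (swapⁿ-fixes⇔even (λ ()) b)
           (subst (λ n → 2 ∣ b ⇔ 2 ∣ n) (2*[1+i]+b≡i+b+[2+i] j' b) (m∣n⇔m∣m*k+n 2 (suc j'))))
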